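{- Let $D$ be a digraph. If the girth of $D$ is at least $3$ (including the case that $D$ is acyclic), then there exists a temporization $\lambda: A(D)\to 2^{\mathbb{N}}\setminus\{\emptyset\}$ such that $(D,\lambda)$ contains no temporal simple-cycle; if the girth of $D$ is $2$, no such temporization exists.
   Context: $D$ is a finite simple digraph (no loops or parallel arcs; opposite arcs $uv,vu$ allowed). A cycle of $D$ is a closed directed path $(v_1,\dots,v_q,v_1)$ with $q\ge2$ and $v_1,\dots,v_q$ distinct; its length is $q$; the girth of $D$ is the minimum length of a cycle. Non-strict model: a temporal walk in $(D,\lambda)$ is a sequence $(v_1,t_1,v_2,\dots,v_q,t_q,v_{q+1})$ with $q\ge1$, $v_iv_{i+1}\in A(D)$, $t_i\in\lambda(v_iv_{i+1})$, and $t_1\le\dots\le t_q$. A temporal $x,x$-path is such a walk with $v_1=v_{q+1}=x$ and $v_1,\dots,v_q$ distinct; its arc set is $\{v_iv_{i+1}\}$. A cycle $C$ is a temporal simple-cycle if there is $x\in V(C)$ and a temporal $x,x$-path whose arc set equals the arc set of $C$. -}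

module Defs where

open import Data.Nat using (ℕ; _≤_)
open import Data.Fin using (Fin)
open import Data.Bool using (Bool; true; false)
open import Data.List using (List; []; _∷_; length; map)
open import Data.List.Relation.Unary.All using (All)
open import Data.List.Relation.Unary.Unique.Propositional using (Unique)
open import Data.List.Relation.Unary.Linked using (Linked)
open import Data.List.Membership.Propositional using (_∈_)
open import Data.Product using (Σ; ∃; ∃-syntax; _×_; _,_; proj₁; proj₂)
open import Relation.Binary.PropositionalEquality using (_≡_)
open import Relation.Nullary using (¬_)
open import Function.Bundles using (_⇔_)

-- A finite simple digraph on vertex set Fin n: adjacency given by a Boolean
-- matrix (so no parallel arcs), with no loops.  Opposite arcs are allowed.
record Digraph : Set where
  field
    n       : ℕ
    arc     : Fin n → Fin n → Bool
    loopless : ∀ v → arc v v ≡ false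

open Digraph public

Arc : (D : Digraph) → Fin (n D) → Fin (n D) → Set
Arc D u v = arc D u v ≡ true

pairsTo : {A : Set} → A → List A → List (A × A)
pairsTo x [] = []
pairsTo x (y ∷ []) = (y , x) ∷ []
pairsTo x (y ∷ z ∷ zs) = (y , z) ∷ pairsTo x (z ∷ zs)

closedPairs : {A : Set} → List A → List (A × A)
closedPairs [] = []
closedPairs (x ∷ xs) = pairsTo x (x ∷ xs)

IsCycle : (D : Digraph) → List (Fin (n D)) → Set
IsCycle D vs = (2 ≤ length vs) × Unique vs × All (λ p → Arc D (proj₁ p) (proj₂ p)) (closedPairs vs)

GirthAtLeast3 : Digraph → Set
GirthAtLeast3 D = ∀ vs → IsCycle D vs → 3 ≤ length vs

-- girth = 2: there is a cycle of length 2 (all cycles have length ≥ 2 by definition)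
GirthIs2 : Digraph → Set
GirthIs2 D = ∃[ vs ] (IsCycle D vs × length vs ≡ 2)

-- A time-labelling: to each ordered pair of vertices a set of naturals
-- (a subset of ℕ, represented as a predicate).  Only values on arcs matter.
Labelling : Digraph → Set₁
Labelling D = Fin (n D) → Fin (n D) → ℕ → Set

IsTemporization : (D : Digraph) → Labelling D → Set
IsTemporization D λ' = ∀ u v → Arc D u v → ∃[ t ] λ' u v t

stepsTo : {A : Set} → A → List (A × ℕ) → List (A × A × ℕ)
stepsTo x [] = []
stepsTo x ((y , t) ∷ []) = (y , x , t) ∷ []
stepsTo x ((y , t) ∷ (z , s) ∷ zs) = (y , z , t) ∷ stepsTo x ((z , s) ∷ zs)

-- A temporal x,x-path (v₁,t₁,v₂,…,v_q,t_q,v_{q+1}) with v₁ = v_{q+1} = x,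
-- encoded by the list ps = ((v₁,t₁) ∷ … ∷ (v_q,t_q)), q ≥ 1.
TemporalClosedPath : (D : Digraph) → Labelling D → Fin (n D) → List (Fin (n D) × ℕ) → Set
TemporalClosedPath D λ' x ps =
  (∃[ rest ] map proj₁ ps ≡ x ∷ rest)
  × Unique (map proj₁ ps)
  × Linked _≤_ (map proj₂ ps)
  × All (λ s → Arc D (proj₁ s) (proj₁ (proj₂ s)) × λ' (proj₁ s) (proj₁ (proj₂ s)) (proj₂ (proj₂ s)))
        (stepsTo x ps)

pathArcs : {A : Set} → A → List (A × ℕ) → List (A × A)
pathArcs x ps = map (λ s → proj₁ s , proj₁ (proj₂ s)) (stepsTo x ps)

IsTemporalSimpleCycle : (D : Digraph) → Labelling D → List (Fin (n D)) → Set
IsTemporalSimpleCycle D λ' vs =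
  IsCycle D vs ×
  ∃[ x ] (x ∈ vs × ∃[ ps ] (TemporalClosedPath D λ' x ps
                            × (∀ u v → ((u , v) ∈ closedPairs vs ⇔ (u , v) ∈ pathArcs x ps))))

HasTemporalSimpleCycle : (D : Digraph) → Labelling D → Set
HasTemporalSimpleCycle D λ' = ∃[ vs ] IsTemporalSimpleCycle D λ' vs

-- Number the vertices 0,…,N−1 and give each arc a single time: a descending
-- arc u → v gets time v, an ascending one gets 2N − v.  Along a walk with
-- nondecreasing times an ascent can then only be the last step and a descent
-- only the first, so every temporal walk has at most two arcs; without loops
-- and 2-cycles no temporal closed path remains.  Conversely, the two arcs of
-- a 2-cycle can always be traversed in the order of their times.
module Submission where

open import Defs
open import Data.Product using (_×_; ∃-syntax; _,_; proj₁; proj₂)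
open import Relation.Nullary using (¬_; yes; no)

open import Data.Empty using (⊥-elim)
open import Data.Nat using (ℕ; _+_; _∸_; _≤_; _<_; _<?_)
open import Data.Nat.Properties
  using (≤-refl; ≤-trans; ≤-antisym; ≤-total; <-irrefl; <⇒≤; ≮⇒≥; ≤-<-trans; m≤m+n; +-cancelˡ-≤; ∸-monoʳ-<)
open import Data.Fin using (Fin; toℕ)
open import Data.Fin.Properties using (toℕ<n; toℕ-injective)
open import Data.Sum using (inj₁; inj₂)
open import Data.List using (List; []; _∷_; map)
open import Data.List.Relation.Unary.All using (All; []; _∷_)
open import Data.List.Relation.Unary.Any using (here; there)
open import Data.List.Relation.Unary.AllPairs using ([]; _∷_)
open import Data.List.Relation.Unary.Linked using (Linked; [-]; _∷_)
open import Data.List.Relation.Binary.Permutation.Propositional using (↭-swap; ↭-refl)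
open import Data.List.Relation.Binary.Permutation.Propositional.Properties using (∈-resp-↭)
open import Function using (_∘_)
open import Function.Bundles using (mk⇔)
open import Function.Construct.Identity using (⇔-id)
open import Relation.Binary.PropositionalEquality using (_≡_; refl; sym; trans)

arcTime : ℕ → ℕ → ℕ → ℕ
arcTime N a b with a <? b
... | yes _ = N + (N ∸ b)
... | no _  = b

ascending-time-exceeds : ∀ N b c → c < N → ¬ (N + (N ∸ b) ≤ c)
ascending-time-exceeds N b c c<N le = <-irrefl refl (≤-<-trans (≤-trans (m≤m+n N (N ∸ b)) le) c<N)

first-step-descends : ∀ N a b c → c < N → arcTime N a b ≤ arcTime N b c → b ≤ a
first-step-descends N a b c c<N le with a <? b | b <? c
... | yes _  | yes b<c = ⊥-elim (<-irrefl refl (≤-<-trans (+-cancelˡ-≤ N _ _ le) (∸-monoʳ-< b<c (<⇒≤ c<N))))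
... | yes _  | no _    = ⊥-elim (ascending-time-exceeds N b c c<N le)
... | no a≮b | _       = ≮⇒≥ a≮b

second-step-ascends : ∀ N a b c → c < N → arcTime N a b ≤ arcTime N b c → b ≤ c
second-step-ascends N a b c c<N le with a <? b | b <? c
... | _     | yes b<c = <⇒≤ b<c
... | yes _ | no _    = ⊥-elim (ascending-time-exceeds N b c c<N le)
... | no _  | no _    = le

middle-step-is-loop : ∀ N a b c d → c < N → d < N
  → arcTime N a b ≤ arcTime N b c → arcTime N b c ≤ arcTime N c d → b ≡ c
middle-step-is-loop N a b c d c<N d<N ab≤bc bc≤cd =
  ≤-antisym (second-step-ascends N a b c c<N ab≤bc) (first-step-descends N b c d d<N bc≤cd)

arc-irreflexive : (D : Digraph) {u v : Fin (n D)} → u ≡ v → ¬ Arc D u v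
arc-irreflexive D {u} refl auu with trans (sym auu) (loopless D u)
... | ()

TemporalStep : (D : Digraph) → Labelling D → Fin (n D) × Fin (n D) × ℕ → Set
TemporalStep D λ' s = Arc D (proj₁ s) (proj₁ (proj₂ s)) × λ' (proj₁ s) (proj₁ (proj₂ s)) (proj₂ (proj₂ s))

head-step : ∀ {A : Set} {P : A × A × ℕ → Set} (x c : A) (r : ℕ) (rest : List (A × ℕ))
  → All P (stepsTo x ((c , r) ∷ rest)) → ∃[ d ] P (c , d , r)
head-step x c r []             (p ∷ _) = x , p
head-step x c r ((d , _) ∷ _) (p ∷ _) = d , p

module _ (D : Digraph) where

  arcTimeᴰ : Fin (n D) → Fin (n D) → ℕ
  arcTimeᴰ u v = arcTime (n D) (toℕ u) (toℕ v)

  singleTime : Labelling D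
  singleTime u v t = t ≡ arcTimeᴰ u v

  singleTime-isTemporization : IsTemporization D singleTime
  singleTime-isTemporization u v _ = arcTimeᴰ u v , refl

  no-three-step-walk : ∀ x a b c t s r rest → Linked _≤_ (t ∷ s ∷ r ∷ map proj₂ rest)
    → ¬ All (TemporalStep D singleTime) (stepsTo x ((a , t) ∷ (b , s) ∷ (c , r) ∷ rest))
  no-three-step-walk x a b c t s r rest (t≤s ∷ s≤r ∷ _) ((_ , refl) ∷ (abc , refl) ∷ later)
    with head-step x c r rest later
  ... | d , (_ , refl) =
    arc-irreflexive D (toℕ-injective (middle-step-is-loop (n D) _ _ _ _ (toℕ<n c) (toℕ<n d) t≤s s≤r)) abc

  no-temporal-closed-path : GirthAtLeast3 D → ∀ x ps → ¬ TemporalClosedPath D singleTime x ps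
  no-temporal-closed-path _ x [] ((_ , ()) , _)
  no-temporal-closed-path _ x ((_ , _) ∷ []) ((_ , refl) , _ , _ , (axx , _) ∷ _) =
    arc-irreflexive D refl axx
  no-temporal-closed-path girth x ((_ , _) ∷ (z , _) ∷ []) ((_ , refl) , distinct , _ , (axz , _) ∷ (azx , _) ∷ _) =
    <-irrefl refl (girth (x ∷ z ∷ []) (≤-refl , distinct , axz ∷ azx ∷ []))
  no-temporal-closed-path _ x ((a , t) ∷ (b , s) ∷ (c , r) ∷ rest) (_ , _ , nondecreasing , steps) =
    no-three-step-walk x a b c t s r rest nondecreasing steps

module _ (D : Digraph) (λ' : Labelling D) where

  two-cycle-reverse : ∀ {u v} → IsCycle D (u ∷ v ∷ []) → IsCycle D (v ∷ u ∷ [])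
  two-cycle-reverse (two , (u≢v ∷ []) ∷ [] ∷ [] , auv ∷ avu ∷ []) =
    two , (u≢v ∘ sym ∷ []) ∷ [] ∷ [] , avu ∷ auv ∷ []

  two-cycle-closed-path : ∀ {u v t s} → IsCycle D (u ∷ v ∷ []) → λ' u v t → λ' v u s → t ≤ s
    → TemporalClosedPath D λ' u ((u , t) ∷ (v , s) ∷ [])
  two-cycle-closed-path (_ , distinct , auv ∷ avu ∷ []) ℓuv ℓvu t≤s =
    (_ , refl) , distinct , t≤s ∷ [-] , (auv , ℓuv) ∷ (avu , ℓvu) ∷ []

  two-cycle-isTemporalSimpleCycle : ∀ {u v} → IsTemporization D λ' → IsCycle D (u ∷ v ∷ [])
    → IsTemporalSimpleCycle D λ' (u ∷ v ∷ [])
  two-cycle-isTemporalSimpleCycle {u} {v} temporization cycle@(_ , _ , auv ∷ avu ∷ [])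
    with temporization u v auv | temporization v u avu
  ... | t , ℓuv | s , ℓvu with ≤-total t s
  ... | inj₁ t≤s = cycle , u , here refl , _ , two-cycle-closed-path cycle ℓuv ℓvu t≤s , λ _ _ → ⇔-id _
  ... | inj₂ s≤t = cycle , v , there (here refl) , _ ,
    two-cycle-closed-path (two-cycle-reverse cycle) ℓvu ℓuv s≤t ,
    λ _ _ → mk⇔ (∈-resp-↭ (↭-swap _ _ ↭-refl)) (∈-resp-↭ (↭-swap _ _ ↭-refl))

lemma3 : (D : Digraph)
    → (GirthAtLeast3 D → ∃[ λ' ] (IsTemporization D λ' × ¬ HasTemporalSimpleCycle D λ'))
    × (GirthIs2 D → ¬ (∃[ λ' ] (IsTemporization D λ' × ¬ HasTemporalSimpleCycle D λ')))
lemma3 D = acyclic-timing , two-cycle-unavoidable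
  where
  acyclic-timing : GirthAtLeast3 D → ∃[ λ' ] (IsTemporization D λ' × ¬ HasTemporalSimpleCycle D λ')
  acyclic-timing girth = singleTime D , singleTime-isTemporization D ,
    λ (_ , _ , x , _ , ps , path , _) → no-temporal-closed-path D girth x ps path

  two-cycle-unavoidable : GirthIs2 D → ¬ (∃[ λ' ] (IsTemporization D λ' × ¬ HasTemporalSimpleCycle D λ'))
  two-cycle-unavoidable ((_ ∷ _ ∷ []) , cycle , refl) (λ' , temporization , none) =
    none (_ , two-cycle-isTemporalSimpleCycle D λ' temporization cycle)
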